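{- Let $T$ be a phylogenetic tree, let $X$ be a cluster of $\Lambda(T)$, and let $r_X$ be the lowest common ancestor in $T$ of the leaves labeled by $X$. For any $v\in V(T)$, the clusters $X$ and $\Lambda(T[v])$ are not compatible if and only if (1) $v$ lies on a path from a child of $r_X$ to some leaf belonging to $X$, and (2) $\Lambda(T[v])\not\subseteq X$.
   Context: A phylogenetic tree is a rooted, unordered, leaf-labeled tree in which every internal node has at least two children and all leaves have distinct labels; $\Lambda(T)$ denotes its leaf labels and $T[v]$ the subtree rooted at $v$. A cluster of $\Lambda(T)$ is a nonempty subset of $\Lambda(T)$. Clusters $C_1,C_2$ are compatible if $C_1\subseteq C_2$, $C_2\subseteq C_1$ or $C_1\cap C_2=\emptyset$. -}

module Defs where

open import Data.Nat using (ℕ; _≤_)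
open import Data.List using (List; []; _∷_; _++_; length)
open import Data.List.Relation.Unary.All using (All)
open import Data.List.Membership.Propositional using (_∈_)
open import Data.List.Relation.Unary.Unique.Propositional using (Unique)
open import Data.List.Relation.Binary.Subset.Propositional using (_⊆_)
open import Data.List.Relation.Binary.Disjoint.Propositional using (Disjoint)
open import Data.Sum using (_⊎_)
open import Data.Product using (_×_; ∃)
open import Relation.Binary.PropositionalEquality using (_≡_)
open import Relation.Nullary using (¬_)

-- Rooted, unordered (children order is irrelevant to all notions below),
-- leaf-labelled trees with labels in ℕ.
data Tree : Set where
  leaf : ℕ → Tree
  node : List Tree → Tree

mutual
  leaves : Tree → List ℕ
  leaves (leaf x)  = x ∷ []
  leaves (node ts) = leavesL ts

  leavesL : List Tree → List ℕ
  leavesL []       = []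
  leavesL (t ∷ ts) = leaves t ++ leavesL ts

data Branching : Tree → Set where
  br-leaf : ∀ {x} → Branching (leaf x)
  br-node : ∀ {ts} → 2 ≤ length ts → All Branching ts → Branching (node ts)

Phylogenetic : Tree → Set
Phylogenetic t = Branching t × Unique (leaves t)

-- vertices of a tree, as positions (paths from the root)
data Pos : Tree → Set where
  here : ∀ {t} → Pos t
  down : ∀ {ts t} → t ∈ ts → Pos t → Pos (node ts)

sub : ∀ {t} → Pos t → Tree
sub {t} here   = t
sub (down _ p) = sub p

data _⊑_ : ∀ {t} → Pos t → Pos t → Set where
  here⊑ : ∀ {t} {q : Pos t} → here ⊑ q
  down⊑ : ∀ {ts t} (m : t ∈ ts) {p q : Pos t} → p ⊑ q → down m p ⊑ down m q

data Child : ∀ {t} → Pos t → Pos t → Set where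
  child-here : ∀ {ts t} (m : t ∈ ts) → Child here (down m here)
  child-down : ∀ {ts t} (m : t ∈ ts) {p c : Pos t} → Child p c → Child (down m p) (down m c)

LeafIn : (T : Tree) → List ℕ → Pos T → Set
LeafIn T X ℓ = ∃ λ x → (x ∈ X) × (sub ℓ ≡ leaf x)

IsCluster : Tree → List ℕ → Set
IsCluster T X = ¬ (X ≡ []) × (X ⊆ leaves T)

IsLCA : (T : Tree) → List ℕ → Pos T → Set
IsLCA T X r =
  (∀ ℓ → LeafIn T X ℓ → r ⊑ ℓ) ×
  (∀ u → (∀ ℓ → LeafIn T X ℓ → u ⊑ ℓ) → u ⊑ r)

Compatible : List ℕ → List ℕ → Set
Compatible C₁ C₂ = (C₁ ⊆ C₂) ⊎ (C₂ ⊆ C₁) ⊎ Disjoint C₁ C₂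

-- Labels are distinct, so a label x lies in Λ(T[v]) exactly when v is an ancestor
-- of the leaf labelled x. Hence X ⊆ Λ(T[v]) iff v is a common ancestor of the
-- X-leaves, i.e. iff v ⊑ r_X. If X and Λ(T[v]) are incompatible they share a
-- label, so v is an ancestor of some X-leaf ℓ, as is r_X; the two are comparable,
-- and since v ⋢ r_X, v lies strictly between r_X and ℓ. Conversely such a v has an
-- X-leaf below it but is not above r_X, so X meets Λ(T[v]) without being contained in it.
module Submission where

open import Defs
open import Data.Nat using (ℕ)
open import Data.Nat.Properties using (_≟_)
open import Data.List using (List; []; _∷_; _++_)
open import Data.List.Relation.Binary.Subset.Propositional using (_⊆_)
open import Data.List.Relation.Binary.Disjoint.Propositional using (Disjoint)
open import Data.List.Relation.Unary.Any using (here; there; any?)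
open import Data.List.Relation.Unary.All using (lookup)
open import Data.List.Relation.Unary.All.Properties using (++⁻ˡ)
open import Data.List.Relation.Unary.AllPairs using ([]; _∷_)
open import Data.List.Relation.Unary.Unique.Propositional using (Unique)
open import Data.List.Membership.Propositional using (_∈_; find; lose)
open import Data.List.Membership.Propositional.Properties using (∈-++⁺ˡ; ∈-++⁺ʳ; ∈-++⁻)
open import Data.List.Membership.DecPropositional _≟_ using (_∈?_)
open import Data.Product using (Σ; _×_; ∃; _,_; proj₁; map₂)
open import Data.Sum using (_⊎_; inj₁; inj₂)
open import Data.Empty using (⊥-elim)
open import Function using (_∘_)
open import Function.Bundles using (_⇔_; mk⇔; Equivalence)
open import Function.Construct.Composition using (_⇔-∘_)
open import Function.Construct.Symmetry using (⇔-sym)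
open import Relation.Nullary using (¬_; yes; no)
open import Relation.Binary.PropositionalEquality using (_≡_; refl; cong; subst; sym)

Unique-++⁻ : ∀ {A : Set} (xs : List A) {ys : List A} → Unique (xs ++ ys) →
             Unique xs × Unique ys × Disjoint xs ys
Unique-++⁻ []       u        = [] , u , λ ()
Unique-++⁻ (x ∷ xs) (x∉ ∷ u) with Unique-++⁻ xs u
... | uxs , uys , xs#ys = ++⁻ˡ xs x∉ ∷ uxs , uys , disjoint
  where
  disjoint : Disjoint (x ∷ xs) _
  disjoint (here refl  , y∈ys) = lookup x∉ (∈-++⁺ʳ xs y∈ys) refl
  disjoint (there y∈xs , y∈ys) = xs#ys (y∈xs , y∈ys)

¬Disjoint⇒∃∈ : (xs ys : List ℕ) → ¬ Disjoint xs ys → ∃ λ x → x ∈ xs × x ∈ ys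
¬Disjoint⇒∃∈ xs ys ¬xs#ys with any? (_∈? ys) xs
... | yes x∈ys  = find x∈ys
... | no  ¬x∈ys = ⊥-elim (¬xs#ys λ (x∈xs , x∈ys) → ¬x∈ys (lose x∈xs x∈ys))

leaves-child-⊆ : ∀ {t ts} → t ∈ ts → leaves t ⊆ leavesL ts
leaves-child-⊆ {ts = t ∷ ts} (here refl) = ∈-++⁺ˡ
leaves-child-⊆ {ts = t ∷ ts} (there m)   = ∈-++⁺ʳ (leaves t) ∘ leaves-child-⊆ m

Unique-child : ∀ {t ts} → Unique (leavesL ts) → t ∈ ts → Unique (leaves t)
Unique-child {ts = t ∷ ts} u m with Unique-++⁻ (leaves t) u | m
... | ut , _   , _ | here refl = ut
... | _  , uts , _ | there m'  = Unique-child uts m'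

-- Equality of the pairs, not just of the subtrees: two equal children at different
-- positions of ts must still be told apart.
child-unique : ∀ {ts t t' x} → Unique (leavesL ts) → (m : t ∈ ts) (m' : t' ∈ ts) →
               x ∈ leaves t → x ∈ leaves t' → _≡_ {A = Σ Tree (_∈ ts)} (t , m) (t' , m')
child-unique {t ∷ ts} u m m' x∈t x∈t' with Unique-++⁻ (leaves t) u | m | m'
... | _ , _   , _    | here refl | here refl = refl
... | _ , _   , t#ts | here refl | there m'₁ = ⊥-elim (t#ts (x∈t , leaves-child-⊆ m'₁ x∈t'))
... | _ , _   , t#ts | there m₁  | here refl = ⊥-elim (t#ts (x∈t' , leaves-child-⊆ m₁ x∈t))
... | _ , uts , _    | there m₁  | there m'₁ = cong (map₂ there) (child-unique uts m₁ m'₁ x∈t x∈t')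

leaves-sub-⊆ : ∀ {t} (p : Pos t) → leaves (sub p) ⊆ leaves t
leaves-sub-⊆ here       = λ x∈ → x∈
leaves-sub-⊆ (down m p) = leaves-child-⊆ m ∘ leaves-sub-⊆ p

⊑⇒leaves-⊇ : ∀ {t} {p q : Pos t} → p ⊑ q → leaves (sub q) ⊆ leaves (sub p)
⊑⇒leaves-⊇ {q = q} here⊑ = leaves-sub-⊆ q
⊑⇒leaves-⊇ (down⊑ m p⊑q) = ⊑⇒leaves-⊇ p⊑q

label∈leaves : ∀ {t x} (ℓ : Pos t) → sub ℓ ≡ leaf x → x ∈ leaves (sub ℓ)
label∈leaves ℓ eq = subst (λ s → _ ∈ leaves s) (sym eq) (here refl)

mutual
  ∈leaves⇒leaf : ∀ {x} (t : Tree) → x ∈ leaves t → ∃ λ (ℓ : Pos t) → sub ℓ ≡ leaf x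
  ∈leaves⇒leaf (leaf y)  (here refl) = here , refl
  ∈leaves⇒leaf (node ts) x∈         with ∈leavesL⇒leaf ts x∈
  ... | t , m , ℓ , eq = down m ℓ , eq

  ∈leavesL⇒leaf : ∀ {x} (ts : List Tree) → x ∈ leavesL ts →
                  ∃ λ t → t ∈ ts × ∃ λ (ℓ : Pos t) → sub ℓ ≡ leaf x
  ∈leavesL⇒leaf (t ∷ ts) x∈ with ∈-++⁻ (leaves t) x∈
  ... | inj₁ x∈t  = t , here refl , ∈leaves⇒leaf t x∈t
  ... | inj₂ x∈ts with ∈leavesL⇒leaf ts x∈ts
  ...   | t' , m , leafₓ = t' , there m , leafₓ

∈leaves-sub⇒leaf-below : ∀ {t x} (p : Pos t) → x ∈ leaves (sub p) →
                         ∃ λ ℓ → p ⊑ ℓ × sub ℓ ≡ leaf x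
∈leaves-sub⇒leaf-below {t} here x∈ with ∈leaves⇒leaf t x∈
... | ℓ , eq = ℓ , here⊑ , eq
∈leaves-sub⇒leaf-below (down m p) x∈ with ∈leaves-sub⇒leaf-below p x∈
... | ℓ , p⊑ℓ , eq = down m ℓ , down⊑ m p⊑ℓ , eq

∈leaves-sub⇒⊑leaf : ∀ {t x} → Unique (leaves t) → (p ℓ : Pos t) →
                    x ∈ leaves (sub p) → sub ℓ ≡ leaf x → p ⊑ ℓ
∈leaves-sub⇒⊑leaf u here       ℓ           x∈ eq = here⊑
∈leaves-sub⇒⊑leaf u (down m p) here        x∈ ()
∈leaves-sub⇒⊑leaf u (down m p) (down m' ℓ) x∈ eq
  with child-unique u m m' (leaves-sub-⊆ p x∈) (leaves-sub-⊆ ℓ (label∈leaves ℓ eq))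
... | refl = down⊑ m (∈leaves-sub⇒⊑leaf (Unique-child u m) p ℓ x∈ eq)

⊑-trans : ∀ {t} {p q s : Pos t} → p ⊑ q → q ⊑ s → p ⊑ s
⊑-trans here⊑         _              = here⊑
⊑-trans (down⊑ m p⊑q) (down⊑ .m q⊑s) = down⊑ m (⊑-trans p⊑q q⊑s)

⊑-common⇒⊑⊎child⊑ : ∀ {t} {p q ℓ : Pos t} → p ⊑ ℓ → q ⊑ ℓ →
                     p ⊑ q ⊎ (∃ λ c → Child q c × c ⊑ p)
⊑-common⇒⊑⊎child⊑ here⊑         _              = inj₁ here⊑
⊑-common⇒⊑⊎child⊑ (down⊑ m p⊑ℓ) here⊑          = inj₂ (down m here , child-here m , down⊑ m here⊑)
⊑-common⇒⊑⊎child⊑ (down⊑ m p⊑ℓ) (down⊑ .m q⊑ℓ) with ⊑-common⇒⊑⊎child⊑ p⊑ℓ q⊑ℓ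
... | inj₁ p⊑q              = inj₁ (down⊑ m p⊑q)
... | inj₂ (c , q→c , c⊑p) = inj₂ (down m c , child-down m q→c , down⊑ m c⊑p)

child⊑⇒⋢ : ∀ {t} {r c v : Pos t} → Child r c → c ⊑ v → ¬ v ⊑ r
child⊑⇒⋢ (child-here m)     (down⊑ .m _)   ()
child⊑⇒⋢ (child-down m r→c) (down⊑ .m c⊑v) (down⊑ .m v⊑r) = child⊑⇒⋢ r→c c⊑v v⊑r

CommonAncestor : (T : Tree) → List ℕ → Pos T → Set
CommonAncestor T X v = ∀ ℓ → LeafIn T X ℓ → v ⊑ ℓ

CommonAncestor⇔⊆leaves : ∀ {T X} → Unique (leaves T) → X ⊆ leaves T → (v : Pos T) →
                         CommonAncestor T X v ⇔ (X ⊆ leaves (sub v))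
CommonAncestor⇔⊆leaves {T} {X} u X⊆ v = mk⇔ to from
  where
  to : CommonAncestor T X v → X ⊆ leaves (sub v)
  to v⊑X {x} x∈X with ∈leaves⇒leaf T (X⊆ x∈X)
  ... | ℓ , eq = ⊑⇒leaves-⊇ (v⊑X ℓ (x , x∈X , eq)) (label∈leaves ℓ eq)

  from : X ⊆ leaves (sub v) → CommonAncestor T X v
  from X⊆v ℓ (x , x∈X , eq) = ∈leaves-sub⇒⊑leaf u v ℓ (X⊆v x∈X) eq

CommonAncestor⇔⊑LCA : ∀ {T X r} → IsLCA T X r → (v : Pos T) → CommonAncestor T X v ⇔ (v ⊑ r)
CommonAncestor⇔⊑LCA (r⊑X , lowest) v =
  mk⇔ (lowest v) (λ v⊑r ℓ ℓ∈X → ⊑-trans v⊑r (r⊑X ℓ ℓ∈X))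

lemma6 : (T : Tree) → Phylogenetic T →
         (X : List ℕ) → IsCluster T X →
         (r : Pos T) → IsLCA T X r →
         (v : Pos T) →
         (¬ Compatible X (leaves (sub v)))
           ⇔ ((∃ λ c → Child r c × ∃ λ ℓ → LeafIn T X ℓ × c ⊑ v × v ⊑ ℓ)
              × ¬ (leaves (sub v) ⊆ X))
lemma6 T (_ , u) X (_ , X⊆T) r lca v = mk⇔ to from
  where
  X⊆v⇔v⊑r : (X ⊆ leaves (sub v)) ⇔ (v ⊑ r)
  X⊆v⇔v⊑r = CommonAncestor⇔⊑LCA lca v ⇔-∘ ⇔-sym (CommonAncestor⇔⊆leaves u X⊆T v)

  OnPathFromChild : Set
  OnPathFromChild = ∃ λ c → Child r c × ∃ λ ℓ → LeafIn T X ℓ × c ⊑ v × v ⊑ ℓ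

  to : ¬ Compatible X (leaves (sub v)) → OnPathFromChild × ¬ (leaves (sub v) ⊆ X)
  to incompatible with ¬Disjoint⇒∃∈ X (leaves (sub v)) (incompatible ∘ inj₂ ∘ inj₂)
  ... | x , x∈X , x∈v with ∈leaves-sub⇒leaf-below v x∈v
  ... | ℓ , v⊑ℓ , eq with ⊑-common⇒⊑⊎child⊑ v⊑ℓ (proj₁ lca ℓ (x , x∈X , eq))
  ... | inj₁ v⊑r = ⊥-elim (incompatible (inj₁ (Equivalence.from X⊆v⇔v⊑r v⊑r)))
  ... | inj₂ (c , r→c , c⊑v) =
    (c , r→c , ℓ , (x , x∈X , eq) , c⊑v , v⊑ℓ) ,
    λ (v⊆X : leaves (sub v) ⊆ X) → incompatible (inj₂ (inj₁ v⊆X))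

  from : OnPathFromChild × ¬ (leaves (sub v) ⊆ X) → ¬ Compatible X (leaves (sub v))
  from ((c , r→c , ℓ , (x , x∈X , eq) , c⊑v , v⊑ℓ) , v⊈X) = λ where
    (inj₁ X⊆v)        → child⊑⇒⋢ r→c c⊑v (Equivalence.to X⊆v⇔v⊑r X⊆v)
    (inj₂ (inj₁ v⊆X)) → v⊈X v⊆X
    (inj₂ (inj₂ X#v)) → X#v (x∈X , ⊑⇒leaves-⊇ v⊑ℓ (label∈leaves ℓ eq))
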